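{- Let $\mathbb{K} = (K, \cup, \cdot, ()^\ast, 1, 0)$ be a Kleene algebra and let $\mathbb{S}=(S,\sqcup,0_s)$ be its kernel. Then $\mathbb{S}$ is a join-semilattice with bottom element $0_s$ (with respect to the order $S$ inherits from $K$). If moreover $\mathbb{K}$ is continuous, then $\mathbb{S}$ is a complete join-semilattice.
   Context: A Kleene algebra is a structure $(K, \cup, \cdot, ()^\ast, 1, 0)$ such that: (K1) $(K,\cup,0)$ is a join-semilattice with bottom $0$ (order $\leq$ the induced order); (K2) $(K,\cdot,1)$ is a monoid, $\cdot$ preserves $\cup$ in each coordinate, and $0$ is an annihilator for $\cdot$; (K3) $1\cup\alpha\cdot\alpha^\ast\leq\alpha^\ast$, $1\cup\alpha^\ast\cdot\alpha\leq\alpha^\ast$, $1\cup\alpha^\ast\cdot\alpha^\ast\leq\alpha^\ast$; (K4) $\alpha\cdot\beta\leq\beta$ implies $\alpha^\ast\cdot\beta\leq\beta$; (K5) $\beta\cdot\alpha\leq\beta$ implies $\beta\cdot\alpha^\ast\leq\beta$. It is continuous if moreover $(K,\cup,0)$ is a complete join-semilattice, $\cdot$ preserves arbitrary joins in each coordinate, and $\alpha^\ast=\bigcup_{n\geq 0}\alpha^n$ ($\alpha^0=1$, $\alpha^{n+1}=\alpha^n\cdot\alpha$). The kernel of $\mathbb{K}$ is $\mathbb{S}=(S,\sqcup,0_s)$ where $S=\mathsf{Range}(()^\ast)$ (ordered as a subposet of $K$), $\gamma:K\to S$ is $\gamma(\alpha)=\alpha^\ast$, $e:S\hookrightarrow K$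 is the inclusion, $\xi\sqcup\chi:=\gamma(e(\xi)\cup e(\chi))$, and $0_s:=\gamma(0)$. -}

module Defs where

open import Level using (Level; suc; _⊔_)
open import Data.Nat using (ℕ; zero) renaming (suc to sucℕ)
open import Data.Product using (Σ; ∃; _×_; _,_; proj₁)
open import Relation.Unary using (Pred)
open import Relation.Binary.PropositionalEquality using (_≡_)
open import Relation.Binary.Lattice.Structures using (IsBoundedJoinSemilattice)
open import Relation.Binary.Structures using (IsPartialOrder)

record KleeneAlgebra (c : Level) : Set (suc c) where
  infixl 6 _∪_
  infixl 7 _·_
  infix  4 _≤_
  field
    Carrier : Set c
    _∪_     : Carrier → Carrier → Carrier
    _·_     : Carrier → Carrier → Carrier
    _⋆      : Carrier → Carrier
    1#      : Carrier
    0#      : Carrier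

  _≤_ : Carrier → Carrier → Set c
  α ≤ β = α ∪ β ≡ β

  field
    ∪-assoc    : ∀ α β γ → (α ∪ β) ∪ γ ≡ α ∪ (β ∪ γ)
    ∪-comm     : ∀ α β → α ∪ β ≡ β ∪ α
    ∪-idem     : ∀ α → α ∪ α ≡ α
    ∪-identityˡ : ∀ α → 0# ∪ α ≡ α
    ·-assoc    : ∀ α β γ → (α · β) · γ ≡ α · (β · γ)
    ·-identityˡ : ∀ α → 1# · α ≡ α
    ·-identityʳ : ∀ α → α · 1# ≡ α
    ·-distribˡ-∪ : ∀ α β γ → α · (β ∪ γ) ≡ α · β ∪ α · γ
    ·-distribʳ-∪ : ∀ α β γ → (β ∪ γ) · α ≡ β · α ∪ γ · α
    ·-zeroˡ    : ∀ α → 0# · α ≡ 0#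
    ·-zeroʳ    : ∀ α → α · 0# ≡ 0#
    star-unfoldˡ : ∀ α → 1# ∪ α · (α ⋆) ≤ α ⋆
    star-unfoldʳ : ∀ α → 1# ∪ (α ⋆) · α ≤ α ⋆
    star-trans   : ∀ α → 1# ∪ (α ⋆) · (α ⋆) ≤ α ⋆
    star-inductˡ : ∀ α β → α · β ≤ β → (α ⋆) · β ≤ β
    star-inductʳ : ∀ α β → β · α ≤ β → β · (α ⋆) ≤ β

  _^_ : Carrier → ℕ → Carrier
  α ^ zero   = 1#
  α ^ sucℕ n = (α ^ n) · α

IsLub : ∀ {a ℓ p} {A : Set a} → (A → A → Set ℓ) → Pred A p → A → Set (a ⊔ ℓ ⊔ p)
IsLub _≤_ P s = (∀ x → P x → x ≤ s) × (∀ u → (∀ x → P x → x ≤ u) → s ≤ u)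

record IsContinuous {c : Level} (K : KleeneAlgebra c) : Set (suc c) where
  open KleeneAlgebra K
  field
    ⋁       : Pred Carrier c → Carrier
    ⋁-lub   : ∀ P → IsLub _≤_ P (⋁ P)
    ·-⋁ˡ    : ∀ α P → α · ⋁ P ≡ ⋁ (λ z → ∃ λ β → P β × z ≡ α · β)
    ·-⋁ʳ    : ∀ α P → ⋁ P · α ≡ ⋁ (λ z → ∃ λ β → P β × z ≡ β · α)
    star-⋁  : ∀ α → α ⋆ ≡ ⋁ (λ z → ∃ λ n → z ≡ α ^ n)

module Kernel {c : Level} (K : KleeneAlgebra c) where
  open KleeneAlgebra K

  S : Set c
  S = Σ Carrier (λ x → ∃ λ α → α ⋆ ≡ x)

  e : S → Carrier
  e = proj₁

  γ : Carrier → S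
  γ α = (α ⋆ , α , _≡_.refl)

  _⊔ₛ_ : S → S → S
  ξ ⊔ₛ χ = γ (e ξ ∪ e χ)

  0ₛ : S
  0ₛ = γ 0#

  _≈ₛ_ : S → S → Set c
  ξ ≈ₛ χ = e ξ ≡ e χ

  _≤ₛ_ : S → S → Set c
  ξ ≤ₛ χ = e ξ ≤ e χ

  IsBoundedJoinSemilatticeₛ : Set c
  IsBoundedJoinSemilatticeₛ = IsBoundedJoinSemilattice _≈ₛ_ _≤ₛ_ _⊔ₛ_ 0ₛ

  IsCompleteJoinSemilatticeₛ : Set (suc c)
  IsCompleteJoinSemilatticeₛ =
    IsPartialOrder _≈ₛ_ _≤ₛ_ × (∀ (P : Pred S c) → ∃ λ s → IsLub _≤ₛ_ P s)

-- ξ ↦ α⋆ is a closure operator on K whose closed elements are exactly the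
-- reflexive-transitive ones (1 ≤ ξ, ξ · ξ ≤ ξ), and by (K4) α⋆ is the least
-- such element above α. Hence γ is left adjoint to the inclusion e, so the join
-- of a family in S is γ applied to its join in K: γ (e ξ ∪ e χ) for two
-- elements, γ 0 for none, and γ (⋁ …) for any subset when K is complete.
module Submission where

open import Defs
open import Level using (Level)
open import Data.Product using (_×_; _,_; ∃)
open import Relation.Unary using (Pred)
open import Relation.Binary.PropositionalEquality
open import Relation.Binary.Structures using (IsPartialOrder)

module KleeneAlgebraProperties {c : Level} (K : KleeneAlgebra c) where
  open KleeneAlgebra K

  ≤-refl : ∀ α → α ≤ α
  ≤-refl = ∪-idem

  ≤-trans : ∀ {α β δ} → α ≤ β → β ≤ δ → α ≤ δ
  ≤-trans {α} {β} {δ} α≤β β≤δ = begin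
    α ∪ δ        ≡⟨ cong (α ∪_) (sym β≤δ) ⟩
    α ∪ (β ∪ δ)  ≡⟨ sym (∪-assoc α β δ) ⟩
    (α ∪ β) ∪ δ  ≡⟨ cong (_∪ δ) α≤β ⟩
    β ∪ δ        ≡⟨ β≤δ ⟩
    δ            ∎
    where open ≡-Reasoning

  ≤-antisym : ∀ {α β} → α ≤ β → β ≤ α → α ≡ β
  ≤-antisym {α} {β} α≤β β≤α = trans (sym β≤α) (trans (∪-comm β α) α≤β)

  x≤x∪y : ∀ α β → α ≤ α ∪ β
  x≤x∪y α β = trans (sym (∪-assoc α α β)) (cong (_∪ β) (∪-idem α))

  y≤x∪y : ∀ α β → β ≤ α ∪ β
  y≤x∪y α β = subst (β ≤_) (∪-comm β α) (x≤x∪y β α)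

  ∪-least : ∀ {α β δ} → α ≤ δ → β ≤ δ → α ∪ β ≤ δ
  ∪-least {α} {β} {δ} α≤δ β≤δ = trans (∪-assoc α β δ) (trans (cong (α ∪_) β≤δ) α≤δ)

  ·-monoʳ-≤ : ∀ δ {α β} → α ≤ β → δ · α ≤ δ · β
  ·-monoʳ-≤ δ {α} {β} α≤β = trans (sym (·-distribˡ-∪ δ α β)) (cong (δ ·_) α≤β)

  ·-monoˡ-≤ : ∀ δ {α β} → α ≤ β → α · δ ≤ β · δ
  ·-monoˡ-≤ δ {α} {β} α≤β = trans (sym (·-distribʳ-∪ δ α β)) (cong (_· δ) α≤β)

  1≤α⋆ : ∀ α → 1# ≤ α ⋆
  1≤α⋆ α = ≤-trans (x≤x∪y 1# _) (star-unfoldˡ α)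

  α⋆·α⋆≤α⋆ : ∀ α → α ⋆ · α ⋆ ≤ α ⋆
  α⋆·α⋆≤α⋆ α = ≤-trans (y≤x∪y 1# _) (star-trans α)

  α≤α⋆ : ∀ α → α ≤ α ⋆
  α≤α⋆ α = ≤-trans (subst (_≤ α · α ⋆) (·-identityʳ α) (·-monoʳ-≤ α (1≤α⋆ α)))
                   (≤-trans (y≤x∪y 1# _) (star-unfoldˡ α))

  ⋆-least : ∀ {α β} → α ≤ β → 1# ≤ β → β · β ≤ β → α ⋆ ≤ β
  ⋆-least {α} {β} α≤β 1≤β β·β≤β =
    ≤-trans (subst (_≤ α ⋆ · β) (·-identityʳ (α ⋆)) (·-monoʳ-≤ (α ⋆) 1≤β))
            (star-inductˡ α β (≤-trans (·-monoˡ-≤ β α≤β) β·β≤β))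

module KernelProperties {c : Level} (K : KleeneAlgebra c) where
  open KleeneAlgebra K
  open KleeneAlgebraProperties K
  open Kernel K

  ≤-e∘γ : ∀ α → α ≤ e (γ α)
  ≤-e∘γ = α≤α⋆

  ≤-e⇒γ-≤ₛ : ∀ {α} (ξ : S) → α ≤ e ξ → γ α ≤ₛ ξ
  ≤-e⇒γ-≤ₛ (_ , β , refl) α≤β⋆ = ⋆-least α≤β⋆ (1≤α⋆ β) (α⋆·α⋆≤α⋆ β)

  image : Pred S c → Pred Carrier c
  image P α = ∃ λ ξ → P ξ × α ≡ e ξ

  γ-preserves-lub : ∀ {P : Pred S c} {σ} → IsLub _≤_ (image P) σ → IsLub _≤ₛ_ P (γ σ)
  γ-preserves-lub (upper , least) =
      (λ ξ Pξ → ≤-trans (upper (e ξ) (ξ , Pξ , refl)) (≤-e∘γ _))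
    , (λ υ bound → ≤-e⇒γ-≤ₛ υ (least (e υ) λ { _ (ξ , Pξ , refl) → bound ξ Pξ }))

  ≤ₛ-isPartialOrder : IsPartialOrder _≈ₛ_ _≤ₛ_
  ≤ₛ-isPartialOrder = record
    { isPreorder = record
      { isEquivalence = record { refl = refl ; sym = sym ; trans = trans }
      ; reflexive     = λ {ξ} {χ} ξ≈χ → subst (_≤ e χ) (sym ξ≈χ) (≤-refl (e χ))
      ; trans         = ≤-trans
      }
    ; antisym = ≤-antisym
    }

  isBoundedJoinSemilattice : IsBoundedJoinSemilatticeₛ
  isBoundedJoinSemilattice = record
    { isJoinSemilattice = record
      { isPartialOrder = ≤ₛ-isPartialOrder
      ; supremum       = λ ξ χ →
            ≤-trans (x≤x∪y (e ξ) (e χ)) (≤-e∘γ _)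
          , ≤-trans (y≤x∪y (e ξ) (e χ)) (≤-e∘γ _)
          , λ υ ξ≤υ χ≤υ → ≤-e⇒γ-≤ₛ υ (∪-least ξ≤υ χ≤υ)
      }
    ; minimum = λ ξ → ≤-e⇒γ-≤ₛ ξ (∪-identityˡ (e ξ))
    }

  isCompleteJoinSemilattice : IsContinuous K → IsCompleteJoinSemilatticeₛ
  isCompleteJoinSemilattice continuous =
    ≤ₛ-isPartialOrder , λ P → γ (⋁ (image P)) , γ-preserves-lub (⋁-lub (image P))
    where open IsContinuous continuous

proposition3p3 : ∀ {c : Level} (K : KleeneAlgebra c) → Kernel.IsBoundedJoinSemilatticeₛ K × (IsContinuous K → Kernel.IsCompleteJoinSemilatticeₛ K)
proposition3p3 K = isBoundedJoinSemilattice , isCompleteJoinSemilattice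
  where open KernelProperties K
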